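{- For every positive integer $n$ with $n \equiv 0,4,6 \pmod{7}$, there is no binary LCD $[n,3,\lfloor 4n/7 \rfloor]$ code.
   Context: All codes are binary linear codes; an $[n,k,d]$ code is a $k$-dimensional subspace of $\mathbb{F}_2^n$ with minimum nonzero Hamming weight $d$. A code $C$ is LCD if $C \cap C^\perp = \{\mathbf{0}_n\}$, where $C^\perp$ is the dual with respect to the standard inner product. -}

module Defs where

open import Data.Bool using (Bool; true; false; _xor_; _∧_; if_then_else_)
open import Data.Nat using (ℕ; zero; suc; _≤_)
open import Data.Vec using (Vec; []; _∷_; replicate; zipWith)
open import Data.Product using (Σ; ∃; _×_)
open import Relation.Binary.PropositionalEquality using (_≡_; _≢_)

Word : ℕ → Set
Word n = Vec Bool n

𝟎 : ∀ {n} → Word n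
𝟎 = replicate _ false

_⊕_ : ∀ {n} → Word n → Word n → Word n
_⊕_ = zipWith _xor_

wt : ∀ {n} → Word n → ℕ
wt []           = zero
wt (true  ∷ w)  = suc (wt w)
wt (false ∷ w)  = wt w

_·_ : ∀ {n} → Word n → Word n → Bool
[]       · []       = false
(a ∷ u)  · (b ∷ v)  = (a ∧ b) xor (u · v)

GenMat : ℕ → ℕ → Set
GenMat k n = Vec (Word n) k

combo : ∀ {k n} → GenMat k n → Vec Bool k → Word n
combo []       []       = 𝟎
combo (g ∷ G)  (c ∷ cs) = (if c then g else 𝟎) ⊕ combo G cs

_∈C_ : ∀ {k n} → Word n → GenMat k n → Set
w ∈C G = ∃ λ c → combo G c ≡ w

LinIndep : ∀ {k n} → GenMat k n → Set
LinIndep G = ∀ c → combo G c ≡ 𝟎 → c ≡ replicate _ false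

MinDist : ∀ {k n} → GenMat k n → ℕ → Set
MinDist G d =
  (∀ w → w ∈C G → w ≢ 𝟎 → d ≤ wt w) ×
  (∃ λ w → w ∈C G × w ≢ 𝟎 × wt w ≡ d)

Is[_,_,_]Code : (n k d : ℕ) → GenMat k n → Set
Is[ n , k , d ]Code G = LinIndep G × MinDist G d

IsLCD : ∀ {k n} → GenMat k n → Set
IsLCD G = ∀ w → w ∈C G → (∀ v → v ∈C G → w · v ≡ false) → w ≡ 𝟎

-- Write n = 7m + 2r and d = 4m + r with r ∈ {0, 2, 3}, and let X v count the columns of a
-- generator matrix G equal to v ∈ F₂³, so that uG has weight Σ_w X w [u · w].  Summing the
-- weights of the four codewords with u · v = 1, and of the three nonzero ones with u · v = 0,
-- and comparing with d forces X 0 = 0 and m ≤ X v ≤ m + 1 for v ≠ 0.  So G consists of m copies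
-- of the simplex code, which is self-orthogonal, plus 2r excess columns forming a code of minimum
-- weight ≥ r.  Searching all 2⁸ sets of excess columns shows that for r ∈ {0, 2, 3} some c ≠ 0
-- gives an excess codeword orthogonal to all excess codewords; then cG lies in C ∩ C^⊥.
module Submission where

open import Defs
open import Data.Bool using (Bool; true; false; _xor_; _∧_; _∨_; not; T; if_then_else_)
open import Data.Empty using (⊥-elim)
open import Data.Nat using (ℕ; zero; suc; _+_; _*_; _≤_; _<_; z≤n; s≤s; z<s; _/_; _%_; parity)
open import Data.Nat.DivMod using (m≡m%n+[m/n]*n; +-distrib-/-∣ʳ; m*n/n≡m)
open import Data.Nat.Divisibility using (divides-refl)
open import Data.Nat.Properties
open import Algebra.Properties.CommutativeSemigroup +-commutativeSemigroup using (interchange)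
open import Algebra.Properties.CommutativeSemigroup *-commutativeSemigroup using (x∙yz≈y∙xz)
open import Data.Nat.Tactic.RingSolver using (solve-∀)
open import Data.Parity.Base using (Parity; 0ℙ; 1ℙ)
import Data.Parity.Base as ℙ
import Data.Parity.Properties as ℙ
open import Data.Product using (Σ; ∃; _×_; _,_; proj₁; proj₂; uncurry)
open import Data.Sum using (_⊎_; inj₁; inj₂; [_,_]′)
open import Data.Vec using (Vec; []; _∷_; replicate; zipWith; map)
open import Data.Vec.Properties using (map-replicate)
open import Function using (_∘_)
open import Relation.Binary.PropositionalEquality
open import Relation.Nullary using (¬_; Dec)
open import Relation.Nullary.Decidable using (map′; _×-dec_; _⊎-dec_; _→-dec_; from-yes; T?)

private variable
  j k n : ℕ

-- Sums over F₂^k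

𝟙 : Bool → ℕ
𝟙 false = 0
𝟙 true  = 1

∑ : (Word k → ℕ) → ℕ
∑ {zero}  f = f []
∑ {suc k} f = ∑ (f ∘ (false ∷_)) + ∑ (f ∘ (true ∷_))

∑-cong : {f g : Word k → ℕ} → (∀ w → f w ≡ g w) → ∑ f ≡ ∑ g
∑-cong {zero}  f≗g = f≗g []
∑-cong {suc k} f≗g = cong₂ _+_ (∑-cong (f≗g ∘ (false ∷_))) (∑-cong (f≗g ∘ (true ∷_)))

∑-zero : ∑ {k} (λ _ → 0) ≡ 0
∑-zero {zero}  = refl
∑-zero {suc k} = cong₂ _+_ (∑-zero {k}) (∑-zero {k})

∑-+ : (f g : Word k → ℕ) → ∑ (λ w → f w + g w) ≡ ∑ f + ∑ g
∑-+ {zero}  f g = refl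
∑-+ {suc k} f g = begin
  ∑ (λ w → f (false ∷ w) + g (false ∷ w)) + ∑ (λ w → f (true ∷ w) + g (true ∷ w))
    ≡⟨ cong₂ _+_ (∑-+ (f ∘ (false ∷_)) (g ∘ (false ∷_)))
                 (∑-+ (f ∘ (true ∷_)) (g ∘ (true ∷_))) ⟩
  (∑ (f ∘ (false ∷_)) + ∑ (g ∘ (false ∷_))) + (∑ (f ∘ (true ∷_)) + ∑ (g ∘ (true ∷_)))
    ≡⟨ interchange (∑ (f ∘ (false ∷_))) _ _ _ ⟩
  (∑ (f ∘ (false ∷_)) + ∑ (f ∘ (true ∷_))) + (∑ (g ∘ (false ∷_)) + ∑ (g ∘ (true ∷_)))
    ∎
  where open ≡-Reasoning

∑-*ˡ : ∀ a (f : Word k → ℕ) → ∑ (λ w → a * f w) ≡ a * ∑ f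
∑-*ˡ {zero}  a f = refl
∑-*ˡ {suc k} a f =
  trans (cong₂ _+_ (∑-*ˡ a (f ∘ (false ∷_))) (∑-*ˡ a (f ∘ (true ∷_)))) (sym (*-distribˡ-+ a _ _))

∑-mono-≤ : {f g : Word k → ℕ} → (∀ w → f w ≤ g w) → ∑ f ≤ ∑ g
∑-mono-≤ {zero}  f≤g = f≤g []
∑-mono-≤ {suc k} f≤g = +-mono-≤ (∑-mono-≤ (f≤g ∘ (false ∷_))) (∑-mono-≤ (f≤g ∘ (true ∷_)))

∑-comm : (f : Word j → Word k → ℕ) → ∑ (λ u → ∑ (f u)) ≡ ∑ (λ w → ∑ (λ u → f u w))
∑-comm {zero}  f = refl
∑-comm {suc j} f =
  trans (cong₂ _+_ (∑-comm (f ∘ (false ∷_))) (∑-comm (f ∘ (true ∷_))))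
        (sym (∑-+ (λ w → ∑ (λ u → f (false ∷ u) w)) (λ w → ∑ (λ u → f (true ∷ u) w))))

δ : Word k → Word k → ℕ
δ []          []          = 1
δ (false ∷ v) (false ∷ w) = δ v w
δ (true ∷ v)  (true ∷ w)  = δ v w
δ (false ∷ v) (true ∷ w)  = 0
δ (true ∷ v)  (false ∷ w) = 0

∑-δ : (v : Word k) (f : Word k → ℕ) → ∑ (λ w → δ v w * f w) ≡ f v
∑-δ         []          f = +-identityʳ (f [])
∑-δ {suc k} (false ∷ v) f = trans (cong₂ _+_ (∑-δ v (f ∘ (false ∷_))) (∑-zero {k})) (+-identityʳ _)
∑-δ {suc k} (true ∷ v)  f = cong₂ _+_ (∑-zero {k}) (∑-δ v (f ∘ (true ∷_)))

⟨_,_⟩ : (Word k → ℕ) → (Word k → ℕ) → ℕ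
⟨ f , g ⟩ = ∑ λ w → f w * g w

⟨⟩-congˡ : {f g : Word k → ℕ} (h : Word k → ℕ) → (∀ w → f w ≡ g w) →
  ⟨ f , h ⟩ ≡ ⟨ g , h ⟩
⟨⟩-congˡ h f≗g = ∑-cong λ w → cong (_* h w) (f≗g w)

⟨⟩-congʳ : (f : Word k → ℕ) {g h : Word k → ℕ} → (∀ w → g w ≡ h w) →
  ⟨ f , g ⟩ ≡ ⟨ f , h ⟩
⟨⟩-congʳ f g≗h = ∑-cong λ w → cong (f w *_) (g≗h w)

⟨⟩-+ˡ : (f g h : Word k → ℕ) → ⟨ (λ w → f w + g w) , h ⟩ ≡ ⟨ f , h ⟩ + ⟨ g , h ⟩
⟨⟩-+ˡ {k} f g h = trans (∑-cong λ w → *-distribʳ-+ (h w) (f w) (g w)) (∑-+ {k} _ _)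

⟨⟩-+ʳ : (f g h : Word k → ℕ) → ⟨ f , (λ w → g w + h w) ⟩ ≡ ⟨ f , g ⟩ + ⟨ f , h ⟩
⟨⟩-+ʳ {k} f g h = trans (∑-cong λ w → *-distribˡ-+ (f w) (g w) (h w)) (∑-+ {k} _ _)

⟨⟩-+ʳ-≗ : (f g h : Word k → ℕ) {e : Word k → ℕ} → (∀ w → g w + h w ≡ e w) →
  ⟨ f , g ⟩ + ⟨ f , h ⟩ ≡ ⟨ f , e ⟩
⟨⟩-+ʳ-≗ f g h g+h≗e = trans (sym (⟨⟩-+ʳ f g h)) (⟨⟩-congʳ f g+h≗e)

⟨⟩-*ˡ : ∀ a (f g : Word k → ℕ) → ⟨ (λ w → a * f w) , g ⟩ ≡ a * ⟨ f , g ⟩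
⟨⟩-*ˡ {k} a f g = trans (∑-cong λ w → *-assoc a (f w) (g w)) (∑-*ˡ {k} a _)

⟨⟩-*ʳ : ∀ a (f g : Word k → ℕ) → ⟨ f , (λ w → a * g w) ⟩ ≡ a * ⟨ f , g ⟩
⟨⟩-*ʳ {k} a f g = trans (∑-cong λ w → x∙yz≈y∙xz (f w) a (g w)) (∑-*ˡ {k} a _)

⟨δ⟩ˡ : ∀ v (f : Word k → ℕ) → ⟨ δ v , f ⟩ ≡ f v
⟨δ⟩ˡ = ∑-δ

⟨δ⟩ʳ : ∀ (f : Word k → ℕ) v → ⟨ f , δ v ⟩ ≡ f v
⟨δ⟩ʳ f v = trans (∑-cong λ w → *-comm (f w) (δ v w)) (∑-δ v f)

⟨⟩-swap : (ι X : Word k → ℕ) (g : Word k → Word k → ℕ) →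
  ⟨ ι , (λ u → ⟨ X , g u ⟩) ⟩ ≡ ⟨ X , (λ w → ⟨ ι , (λ u → g u w) ⟩) ⟩
⟨⟩-swap {k} ι X g = begin
  ∑ (λ u → ι u * ∑ (λ w → X w * g u w))
    ≡⟨ ∑-cong (λ u → sym (∑-*ˡ (ι u) (λ w → X w * g u w))) ⟩
  ∑ (λ u → ∑ (λ w → ι u * (X w * g u w)))
    ≡⟨ ∑-comm {k} {k} (λ u w → ι u * (X w * g u w)) ⟩
  ∑ (λ w → ∑ (λ u → ι u * (X w * g u w)))
    ≡⟨ ∑-cong (λ w → ∑-cong (λ u → x∙yz≈y∙xz (ι u) (X w) (g u w))) ⟩
  ∑ (λ w → ∑ (λ u → X w * (ι u * g u w)))
    ≡⟨ ∑-cong (λ w → ∑-*ˡ (X w) (λ u → ι u * g u w)) ⟩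
  ∑ (λ w → X w * ∑ (λ u → ι u * g u w))
    ∎
  where open ≡-Reasoning

⟨⟩-split : ∀ m (X ν s : Word k → ℕ) → (∀ w → X w ≡ m * ν w + s w) →
  ∀ g → ⟨ X , g ⟩ ≡ m * ⟨ ν , g ⟩ + ⟨ s , g ⟩
⟨⟩-split m X ν s X≗ g =
  trans (⟨⟩-congˡ g X≗)
        (trans (⟨⟩-+ˡ (λ w → m * ν w) s g) (cong (_+ ⟨ s , g ⟩) (⟨⟩-*ˡ m ν g)))

-- Codes through their column multiplicities

columns : GenMat k n → Vec (Word k) n
columns []      = replicate _ []
columns (g ∷ G) = zipWith _∷_ g (columns G)

multiplicity : Vec (Word k) n → Word k → ℕ
multiplicity []           w = 0
multiplicity (col ∷ cols) w = δ col w + multiplicity cols w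

⟨multiplicity-[]⟩ : (h : Word k → ℕ) → ⟨ multiplicity [] , h ⟩ ≡ 0
⟨multiplicity-[]⟩ {k} h = ∑-zero {k}

⟨multiplicity-∷⟩ : ∀ col (cols : Vec (Word k) n) h →
  ⟨ multiplicity (col ∷ cols) , h ⟩ ≡ h col + ⟨ multiplicity cols , h ⟩
⟨multiplicity-∷⟩ col cols h = trans (⟨⟩-+ˡ (δ col) (multiplicity cols) h) (cong (_+ _) (⟨δ⟩ˡ col h))

multiplicity-total : (cols : Vec (Word k) n) → ⟨ multiplicity cols , (λ _ → 1) ⟩ ≡ n
multiplicity-total {k} []           = ⟨multiplicity-[]⟩ {k} (λ _ → 1)
multiplicity-total (col ∷ cols) = trans (⟨multiplicity-∷⟩ col cols _) (cong suc (multiplicity-total cols))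

combo-columns : (G : GenMat k n) (c : Word k) → combo G c ≡ map (c ·_) (columns G)
combo-columns []      []       = sym (map-replicate ([] ·_) [] _)
combo-columns (g ∷ G) (b ∷ c) =
  trans (cong ((if b then g else 𝟎) ⊕_) (combo-columns G c)) (addRow b g (columns G))
  where
  addRow : ∀ {n} b (g : Word n) cols →
    (if b then g else 𝟎) ⊕ map (c ·_) cols ≡ map ((b ∷ c) ·_) (zipWith _∷_ g cols)
  addRow true  []      []           = refl
  addRow false []      []           = refl
  addRow true  (x ∷ g) (col ∷ cols) = cong (_ ∷_) (addRow true g cols)
  addRow false (x ∷ g) (col ∷ cols) = cong (_ ∷_) (addRow false g cols)

wt-map : (p : Word k → Bool) (cols : Vec (Word k) n) → wt (map p cols) ≡ ⟨ multiplicity cols , 𝟙 ∘ p ⟩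
wt-map p []           = sym (⟨multiplicity-[]⟩ (𝟙 ∘ p))
wt-map p (col ∷ cols) =
  trans (wt-∷ (p col) _) (trans (cong (𝟙 (p col) +_) (wt-map p cols)) (sym (⟨multiplicity-∷⟩ col cols _)))
  where
  wt-∷ : ∀ {n} b (w : Word n) → wt (b ∷ w) ≡ 𝟙 b + wt w
  wt-∷ true  w = refl
  wt-∷ false w = refl

toParity : Bool → Parity
toParity false = 0ℙ
toParity true  = 1ℙ

·-map : (p q : Word k → Bool) (cols : Vec (Word k) n) →
  toParity (map p cols · map q cols) ≡ parity ⟨ multiplicity cols , (λ w → 𝟙 (p w ∧ q w)) ⟩
·-map p q []           = sym (cong parity (⟨multiplicity-[]⟩ λ w → 𝟙 (p w ∧ q w)))
·-map p q (col ∷ cols) = begin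
  toParity ((p col ∧ q col) xor (map p cols · map q cols))
    ≡⟨ toParity-xor (p col ∧ q col) _ ⟩
  toParity (p col ∧ q col) ℙ.+ toParity (map p cols · map q cols)
    ≡⟨ cong₂ ℙ._+_ (toParity-𝟙 (p col ∧ q col)) (·-map p q cols) ⟩
  parity (𝟙 (p col ∧ q col)) ℙ.+ parity ⟨ multiplicity cols , h ⟩
    ≡⟨ ℙ.+-homo-+ (𝟙 (p col ∧ q col)) _ ⟨
  parity (𝟙 (p col ∧ q col) + ⟨ multiplicity cols , h ⟩)
    ≡⟨ cong parity (⟨multiplicity-∷⟩ col cols h) ⟨
  parity ⟨ multiplicity (col ∷ cols) , h ⟩
    ∎
  where
  open ≡-Reasoning
  h : _ → ℕ
  h w = 𝟙 (p w ∧ q w)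
  toParity-xor : ∀ a b → toParity (a xor b) ≡ toParity a ℙ.+ toParity b
  toParity-xor false b     = refl
  toParity-xor true  false = refl
  toParity-xor true  true  = refl
  toParity-𝟙 : ∀ b → toParity b ≡ parity (𝟙 b)
  toParity-𝟙 false = refl
  toParity-𝟙 true  = refl

nonzero? : Word k → Bool
nonzero? []      = false
nonzero? (b ∷ w) = b ∨ nonzero? w

nonzero⇒≢𝟎 : (w : Word k) → T (nonzero? w) → w ≢ 𝟎
nonzero⇒≢𝟎 (true ∷ w)  _  ()
nonzero⇒≢𝟎 (false ∷ w) nz refl = nonzero⇒≢𝟎 w nz refl

zero⇒≡𝟎 : (w : Word k) → nonzero? w ≡ false → w ≡ 𝟎
zero⇒≡𝟎 []          _  = refl
zero⇒≡𝟎 (false ∷ w) nz = cong (false ∷_) (zero⇒≡𝟎 w nz)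

weight : (Word k → ℕ) → Word k → ℕ
weight X u = ⟨ X , (λ w → 𝟙 (u · w)) ⟩

InHull : (Word k → ℕ) → Word k → Set
InHull X c = ∀ c' → parity ⟨ X , (λ w → 𝟙 (c · w ∧ c' · w)) ⟩ ≡ 0ℙ

HullNontrivial : (Word k → ℕ) → Set
HullNontrivial X = ∃ λ c → T (nonzero? c) × InHull X c

wt-combo : (G : GenMat k n) (c : Word k) → wt (combo G c) ≡ weight (multiplicity (columns G)) c
wt-combo G c = trans (cong wt (combo-columns G c)) (wt-map (c ·_) (columns G))

InHull⇒orthogonal : (G : GenMat k n) (c : Word k) → InHull (multiplicity (columns G)) c →
  ∀ v → v ∈C G → combo G c · v ≡ false
InHull⇒orthogonal G c hull v (c' , refl) = toParity≡0ℙ (begin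
  toParity (combo G c · combo G c')
    ≡⟨ cong₂ (λ x y → toParity (x · y)) (combo-columns G c) (combo-columns G c') ⟩
  toParity (map (c ·_) (columns G) · map (c' ·_) (columns G))
    ≡⟨ ·-map (c ·_) (c' ·_) (columns G) ⟩
  parity ⟨ multiplicity (columns G) , (λ w → 𝟙 (c · w ∧ c' · w)) ⟩
    ≡⟨ hull c' ⟩
  0ℙ ∎)
  where
  open ≡-Reasoning
  toParity≡0ℙ : ∀ {b} → toParity b ≡ 0ℙ → b ≡ false
  toParity≡0ℙ {false} _ = refl

𝟙-*-≤ : ∀ b {d x} → (T b → d ≤ x) → 𝟙 b * d ≤ x
𝟙-*-≤ false _   = z≤n
𝟙-*-≤ true  d≤x = ≤-trans (≤-reflexive (+-identityʳ _)) (d≤x _)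

weight-lowerBound : ∀ {d} (X : Word k → ℕ) → (∀ u → T (nonzero? u) → d ≤ weight X u) →
  ∀ ι → ⟨ ι , 𝟙 ∘ nonzero? ⟩ * d ≤ ⟨ ι , weight X ⟩
weight-lowerBound {k} {d} X d≤wt ι = begin
  ⟨ ι , 𝟙 ∘ nonzero? ⟩ * d
    ≡⟨ *-comm _ d ⟩
  d * ⟨ ι , 𝟙 ∘ nonzero? ⟩
    ≡⟨ ∑-*ˡ {k} d (λ u → ι u * 𝟙 (nonzero? u)) ⟨
  ∑ (λ u → d * (ι u * 𝟙 (nonzero? u)))
    ≡⟨ ∑-cong (λ u → trans (x∙yz≈y∙xz d (ι u) (𝟙 (nonzero? u))) (cong (ι u *_) (*-comm d _))) ⟩
  ∑ (λ u → ι u * (𝟙 (nonzero? u) * d))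
    ≤⟨ ∑-mono-≤ (λ u → *-monoʳ-≤ (ι u) (𝟙-*-≤ (nonzero? u) (d≤wt u))) ⟩
  ⟨ ι , weight X ⟩
    ∎
  where open ≤-Reasoning

inHull-split : ∀ m (X ν s : Word k → ℕ) → (∀ w → X w ≡ m * ν w + s w) →
  ∀ c → InHull ν c → InHull s c → InHull X c
inHull-split m X ν s X≗ c ν-hull s-hull c' = begin
  parity ⟨ X , g ⟩                             ≡⟨ cong parity (⟨⟩-split m X ν s X≗ g) ⟩
  parity (m * ⟨ ν , g ⟩ + ⟨ s , g ⟩)            ≡⟨ ℙ.+-homo-+ (m * ⟨ ν , g ⟩) _ ⟩
  parity (m * ⟨ ν , g ⟩) ℙ.+ parity ⟨ s , g ⟩   ≡⟨ cong₂ ℙ._+_ (ℙ.*-homo-* m _) (s-hull c') ⟩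
  parity m ℙ.* parity ⟨ ν , g ⟩ ℙ.+ 0ℙ          ≡⟨ cong (λ p → parity m ℙ.* p ℙ.+ 0ℙ) (ν-hull c') ⟩
  parity m ℙ.* 0ℙ ℙ.+ 0ℙ                        ≡⟨ cong (ℙ._+ 0ℙ) (ℙ.*-zeroʳ (parity m)) ⟩
  0ℙ                                            ∎
  where
  open ≡-Reasoning
  g : _ → ℕ
  g w = 𝟙 (c · w ∧ c' · w)

∀-Bool? : {P : Bool → Set} → (∀ b → Dec (P b)) → Dec (∀ b → P b)
∀-Bool? P? = map′ (λ (pf , pt) → λ { false → pf ; true → pt }) (λ f → f false , f true)
  (P? false ×-dec P? true)

∃-Bool? : {P : Bool → Set} → (∀ b → Dec (P b)) → Dec (∃ P)
∃-Bool? P? = map′ [ (false ,_) , (true ,_) ]′ (λ { (false , pf) → inj₁ pf ; (true , pt) → inj₂ pt })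
  (P? false ⊎-dec P? true)

∀-Word? : {P : Word k → Set} → (∀ w → Dec (P w)) → Dec (∀ w → P w)
∀-Word? {zero}  P? = map′ (λ p[] → λ { [] → p[] }) (λ f → f []) (P? [])
∀-Word? {suc k} P? = map′ (λ f → λ { (b ∷ w) → f b w }) (λ f b w → f (b ∷ w))
  (∀-Bool? λ b → ∀-Word? λ w → P? (b ∷ w))

∃-Word? : {P : Word k → Set} → (∀ w → Dec (P w)) → Dec (∃ P)
∃-Word? {zero}  P? = map′ ([] ,_) (λ { ([] , p[]) → p[] }) (P? [])
∃-Word? {suc k} P? = map′ (λ (b , w , pbw) → b ∷ w , pbw) (λ { (b ∷ w , pbw) → b , w , pbw })
  (∃-Bool? λ b → ∃-Word? λ w → P? (b ∷ w))

-- Functions Word k → A as value tables, which unlike functions can be enumerated.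
Table : ℕ → Set → Set
Table zero    A = A
Table (suc k) A = Table k A × Table k A

lookup : {A : Set} → Table k A → Word k → A
lookup {zero}  a         []          = a
lookup {suc k} (t₀ , t₁) (false ∷ w) = lookup t₀ w
lookup {suc k} (t₀ , t₁) (true ∷ w)  = lookup t₁ w

tabulate : {A : Set} → (Word k → A) → Table k A
tabulate {zero}  f = f []
tabulate {suc k} f = tabulate (f ∘ (false ∷_)) , tabulate (f ∘ (true ∷_))

lookup∘tabulate : {A : Set} (f : Word k → A) (w : Word k) → lookup (tabulate f) w ≡ f w
lookup∘tabulate {zero}  f []          = refl
lookup∘tabulate {suc k} f (false ∷ w) = lookup∘tabulate (f ∘ (false ∷_)) w
lookup∘tabulate {suc k} f (true ∷ w)  = lookup∘tabulate (f ∘ (true ∷_)) w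

∀-Table? : {P : Table k Bool → Set} → (∀ t → Dec (P t)) → Dec (∀ t → P t)
∀-Table? {zero}  P? = ∀-Bool? P?
∀-Table? {suc k} P? = map′ (λ f (t₀ , t₁) → f t₀ t₁) (λ f t₀ t₁ → f (t₀ , t₁))
  (∀-Table? λ t₀ → ∀-Table? λ t₁ → P? (t₀ , t₁))

inHull? : (X : Word k → ℕ) (c : Word k) → Dec (InHull X c)
inHull? X c = ∀-Word? λ c' → parity ⟨ X , (λ w → 𝟙 (c · w ∧ c' · w)) ⟩ ℙ.≟ 0ℙ

hullNontrivial? : (X : Word k → ℕ) → Dec (HullNontrivial X)
hullNontrivial? X = ∃-Word? λ c → T? (nonzero? c) ×-dec inHull? X c

ShortCode : ℕ → (Word k → ℕ) → Set
ShortCode d X = ⟨ X , (λ _ → 1) ⟩ ≡ 2 * d × (∀ u → T (nonzero? u) → d ≤ weight X u)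

shortCode? : ∀ d (X : Word k → ℕ) → Dec (ShortCode d X)
shortCode? d X =
  (⟨ X , (λ _ → 1) ⟩ ≟ 2 * d) ×-dec ∀-Word? λ u → T? (nonzero? u) →-dec d ≤? weight X u

-- The geometry of F₂³, checked by evaluation

hyperplane-size : ∀ (v : Word 3) → T (nonzero? v) → ⟨ (λ u → 𝟙 (u · v)) , 𝟙 ∘ nonzero? ⟩ ≡ 4
hyperplane-size =
  from-yes (∀-Word? {3} λ v → T? (nonzero? v) →-dec ⟨ (λ u → 𝟙 (u · v)) , 𝟙 ∘ nonzero? ⟩ ≟ 4)

hyperplaneᶜ-size : ∀ (v : Word 3) → T (nonzero? v) →
  ⟨ (λ u → 𝟙 (not (u · v))) , 𝟙 ∘ nonzero? ⟩ ≡ 3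
hyperplaneᶜ-size =
  from-yes (∀-Word? {3} λ v → T? (nonzero? v) →-dec ⟨ (λ u → 𝟙 (not (u · v))) , 𝟙 ∘ nonzero? ⟩ ≟ 3)

hyperplane-incidence : ∀ (v : Word 3) → T (nonzero? v) → ∀ w →
  ⟨ (λ u → 𝟙 (u · v)) , (λ u → 𝟙 (u · w)) ⟩ + 2 * δ 𝟎 w ≡ 2 * (1 + δ v w)
hyperplane-incidence = from-yes (∀-Word? {3} λ v → T? (nonzero? v) →-dec ∀-Word? λ w →
  ⟨ (λ u → 𝟙 (u · v)) , (λ u → 𝟙 (u · w)) ⟩ + 2 * δ 𝟎 w ≟ 2 * (1 + δ v w))

hyperplaneᶜ-incidence : ∀ (v : Word 3) → T (nonzero? v) → ∀ w →
  ⟨ (λ u → 𝟙 (not (u · v))) , (λ u → 𝟙 (u · w)) ⟩ + 2 * (δ 𝟎 w + δ v w) ≡ 2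
hyperplaneᶜ-incidence = from-yes (∀-Word? {3} λ v → T? (nonzero? v) →-dec ∀-Word? λ w →
  ⟨ (λ u → 𝟙 (not (u · v))) , (λ u → 𝟙 (u · w)) ⟩ + 2 * (δ 𝟎 w + δ v w) ≟ 2)

simplex-length : ⟨ 𝟙 ∘ nonzero? {3} , (λ _ → 1) ⟩ ≡ 7
simplex-length = refl

simplex-weight : ∀ (u : Word 3) → T (nonzero? u) → weight (𝟙 ∘ nonzero?) u ≡ 4
simplex-weight = from-yes (∀-Word? {3} λ u → T? (nonzero? u) →-dec weight (𝟙 ∘ nonzero?) u ≟ 4)

simplex-selfOrthogonal : ∀ (c : Word 3) → InHull (𝟙 ∘ nonzero?) c
simplex-selfOrthogonal = from-yes (∀-Word? {3} λ c → inHull? (𝟙 ∘ nonzero?) c)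

ShortCode⇒HullNontrivial : ℕ → Set
ShortCode⇒HullNontrivial d =
  (t : Table 3 Bool) → ShortCode d (𝟙 ∘ lookup t) → HullNontrivial (𝟙 ∘ lookup t)

shortCode⇒hullNontrivial? : ∀ d → Dec (ShortCode⇒HullNontrivial d)
shortCode⇒hullNontrivial? d =
  ∀-Table? {3} λ t → shortCode? d (𝟙 ∘ lookup t) →-dec hullNontrivial? (𝟙 ∘ lookup t)

shortCode⇒hullNontrivial : ∀ d → d ≡ 0 ⊎ d ≡ 2 ⊎ d ≡ 3 → ShortCode⇒HullNontrivial d
shortCode⇒hullNontrivial d (inj₁ refl)        = from-yes (shortCode⇒hullNontrivial? 0)
shortCode⇒hullNontrivial d (inj₂ (inj₁ refl)) = from-yes (shortCode⇒hullNontrivial? 2)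
shortCode⇒hullNontrivial d (inj₂ (inj₂ refl)) = from-yes (shortCode⇒hullNontrivial? 3)

-- Column multiplicities of a [7m + 2r, 3, 4m + r] code

hyperplane-doubleCount : (X : Word 3 → ℕ) (v : Word 3) → T (nonzero? v) →
  ⟨ (λ u → 𝟙 (u · v)) , weight X ⟩ + 2 * X 𝟎 ≡ 2 * (⟨ X , (λ _ → 1) ⟩ + X v)
hyperplane-doubleCount X v nz = begin
  ⟨ ι , weight X ⟩ + 2 * X 𝟎
    ≡⟨ cong₂ _+_ (sym (⟨⟩-swap ι X λ u w → 𝟙 (u · w))) (cong (2 *_) (⟨δ⟩ʳ X 𝟎)) ⟨
  ⟨ X , incidences ⟩ + 2 * ⟨ X , δ 𝟎 ⟩
    ≡⟨ cong (⟨ X , incidences ⟩ +_) (⟨⟩-*ʳ 2 X (δ 𝟎)) ⟨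
  ⟨ X , incidences ⟩ + ⟨ X , (λ w → 2 * δ 𝟎 w) ⟩
    ≡⟨ ⟨⟩-+ʳ-≗ X incidences (λ w → 2 * δ 𝟎 w) (hyperplane-incidence v nz) ⟩
  ⟨ X , (λ w → 2 * (1 + δ v w)) ⟩
    ≡⟨ ⟨⟩-*ʳ 2 X (λ w → 1 + δ v w) ⟩
  2 * ⟨ X , (λ w → 1 + δ v w) ⟩
    ≡⟨ cong (2 *_) (⟨⟩-+ʳ X (λ _ → 1) (δ v)) ⟩
  2 * (⟨ X , (λ _ → 1) ⟩ + ⟨ X , δ v ⟩)
    ≡⟨ cong (λ x → 2 * (⟨ X , (λ _ → 1) ⟩ + x)) (⟨δ⟩ʳ X v) ⟩
  2 * (⟨ X , (λ _ → 1) ⟩ + X v)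
    ∎
  where
  open ≡-Reasoning
  ι incidences : Word 3 → ℕ
  ι u = 𝟙 (u · v)
  incidences w = ⟨ ι , (λ u → 𝟙 (u · w)) ⟩

hyperplaneᶜ-doubleCount : (X : Word 3 → ℕ) (v : Word 3) → T (nonzero? v) →
  ⟨ (λ u → 𝟙 (not (u · v))) , weight X ⟩ + 2 * (X 𝟎 + X v) ≡ 2 * ⟨ X , (λ _ → 1) ⟩
hyperplaneᶜ-doubleCount X v nz = begin
  ⟨ ι , weight X ⟩ + 2 * (X 𝟎 + X v)
    ≡⟨ cong₂ _+_ (sym (⟨⟩-swap ι X λ u w → 𝟙 (u · w)))
                 (cong (2 *_) (cong₂ _+_ (⟨δ⟩ʳ X 𝟎) (⟨δ⟩ʳ X v))) ⟨
  ⟨ X , incidences ⟩ + 2 * (⟨ X , δ 𝟎 ⟩ + ⟨ X , δ v ⟩)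
    ≡⟨ cong (λ x → ⟨ X , incidences ⟩ + 2 * x) (⟨⟩-+ʳ X (δ 𝟎) (δ v)) ⟨
  ⟨ X , incidences ⟩ + 2 * ⟨ X , (λ w → δ 𝟎 w + δ v w) ⟩
    ≡⟨ cong (⟨ X , incidences ⟩ +_) (⟨⟩-*ʳ 2 X (λ w → δ 𝟎 w + δ v w)) ⟨
  ⟨ X , incidences ⟩ + ⟨ X , (λ w → 2 * (δ 𝟎 w + δ v w)) ⟩
    ≡⟨ ⟨⟩-+ʳ-≗ X incidences (λ w → 2 * (δ 𝟎 w + δ v w)) (hyperplaneᶜ-incidence v nz) ⟩
  ⟨ X , (λ _ → 2 * 1) ⟩
    ≡⟨ ⟨⟩-*ʳ 2 X (λ _ → 1) ⟩
  2 * ⟨ X , (λ _ → 1) ⟩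
    ∎
  where
  open ≡-Reasoning
  ι incidences : Word 3 → ℕ
  ι u = 𝟙 (not (u · v))
  incidences w = ⟨ ι , (λ u → 𝟙 (u · w)) ⟩

hyperplane-bound : ∀ m r x₀ x → 4 * (4 * m + r) + 2 * x₀ ≤ 2 * ((7 * m + 2 * r) + x) → m + x₀ ≤ x
hyperplane-bound m r x₀ x h =
  *-cancelˡ-≤ 2 (+-cancelʳ-≤ (2 * (7 * m + 2 * r)) _ _ (subst₂ _≤_ (lhs m r x₀) (rhs m r x) h))
  where
  lhs : ∀ m r x₀ → 4 * (4 * m + r) + 2 * x₀ ≡ 2 * (m + x₀) + 2 * (7 * m + 2 * r)
  lhs = solve-∀
  rhs : ∀ m r x → 2 * ((7 * m + 2 * r) + x) ≡ 2 * x + 2 * (7 * m + 2 * r)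
  rhs = solve-∀

hyperplaneᶜ-bound : ∀ m r x₀ x → r ≤ 3 → 3 * (4 * m + r) + 2 * (x₀ + x) ≤ 2 * (7 * m + 2 * r) →
  x₀ + x ≤ suc m
hyperplaneᶜ-bound m r x₀ x r≤3 h = ≤-pred (*-cancelˡ-< 2 _ _ (begin-strict
  2 * (x₀ + x)      ≤⟨ +-cancelʳ-≤ (3 * (4 * m + r)) _ _ h′ ⟩
  2 * m + r         ≤⟨ +-monoʳ-≤ (2 * m) r≤3 ⟩
  2 * m + 3         <⟨ n<1+n _ ⟩
  suc (2 * m + 3)   ≡⟨ double m ⟩
  2 * suc (suc m)   ∎))
  where
  open ≤-Reasoning
  rhs : ∀ m r → 2 * (7 * m + 2 * r) ≡ (2 * m + r) + 3 * (4 * m + r)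
  rhs = solve-∀
  h′ : 2 * (x₀ + x) + 3 * (4 * m + r) ≤ (2 * m + r) + 3 * (4 * m + r)
  h′ = subst₂ _≤_ (+-comm _ (2 * (x₀ + x))) (rhs m r) h
  double : ∀ m → suc (2 * m + 3) ≡ 2 * suc (suc m)
  double = solve-∀

squeeze : ∀ {m x₀ x} → m + x₀ ≤ x → x₀ + x ≤ suc m → x₀ ≡ 0
squeeze {x₀ = zero}     _  _        = refl
squeeze {m} {suc y} {x} lo (s≤s hi) = ⊥-elim (<-irrefl refl (begin-strict
  m           <⟨ m<m+n m z<s ⟩
  m + suc y   ≤⟨ lo ⟩
  x           ≤⟨ m≤n+m x y ⟩
  y + x       ≤⟨ hi ⟩
  m           ∎))
  where open ≤-Reasoning

columnMultiplicities : ∀ {m r} (X : Word 3 → ℕ) → r ≤ 3 → ⟨ X , (λ _ → 1) ⟩ ≡ 7 * m + 2 * r →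
  (∀ u → T (nonzero? u) → 4 * m + r ≤ weight X u) →
  X 𝟎 ≡ 0 × (∀ v → T (nonzero? v) → m ≤ X v × X v ≤ suc m)
columnMultiplicities {m} {r} X r≤3 length d≤wt = X𝟎≡0 , λ v nz →
  subst (_≤ X v) (trans (cong (m +_) X𝟎≡0) (+-identityʳ m)) (proj₁ (bounds v nz)) ,
  subst (λ x₀ → x₀ + X v ≤ suc m) X𝟎≡0 (proj₂ (bounds v nz))
  where
  open ≤-Reasoning
  d = 4 * m + r
  bounds : ∀ v → T (nonzero? v) → m + X 𝟎 ≤ X v × X 𝟎 + X v ≤ suc m
  bounds v nz = hyperplane-bound m r (X 𝟎) (X v) (begin
      4 * d + 2 * X 𝟎
        ≡⟨ cong (λ a → a * d + 2 * X 𝟎) (hyperplane-size v nz) ⟨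
      ⟨ (λ u → 𝟙 (u · v)) , 𝟙 ∘ nonzero? ⟩ * d + 2 * X 𝟎
        ≤⟨ +-monoˡ-≤ (2 * X 𝟎) (weight-lowerBound X d≤wt (λ u → 𝟙 (u · v))) ⟩
      ⟨ (λ u → 𝟙 (u · v)) , weight X ⟩ + 2 * X 𝟎
        ≡⟨ hyperplane-doubleCount X v nz ⟩
      2 * (⟨ X , (λ _ → 1) ⟩ + X v)
        ≡⟨ cong (λ n → 2 * (n + X v)) length ⟩
      2 * ((7 * m + 2 * r) + X v) ∎) ,
    hyperplaneᶜ-bound m r (X 𝟎) (X v) r≤3 (begin
      3 * d + 2 * (X 𝟎 + X v)
        ≡⟨ cong (λ a → a * d + 2 * (X 𝟎 + X v)) (hyperplaneᶜ-size v nz) ⟨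
      ⟨ (λ u → 𝟙 (not (u · v))) , 𝟙 ∘ nonzero? ⟩ * d + 2 * (X 𝟎 + X v)
        ≤⟨ +-monoˡ-≤ (2 * (X 𝟎 + X v)) (weight-lowerBound X d≤wt (λ u → 𝟙 (not (u · v)))) ⟩
      ⟨ (λ u → 𝟙 (not (u · v))) , weight X ⟩ + 2 * (X 𝟎 + X v)
        ≡⟨ hyperplaneᶜ-doubleCount X v nz ⟩
      2 * ⟨ X , (λ _ → 1) ⟩
        ≡⟨ cong (2 *_) length ⟩
      2 * (7 * m + 2 * r) ∎)
  X𝟎≡0 : X 𝟎 ≡ 0
  X𝟎≡0 = let (lo , hi) = bounds (true ∷ false ∷ false ∷ []) _ in squeeze lo hi

unitExcess : ∀ {m x} → m ≤ x → x ≤ suc m → ∃ λ b → x ≡ m + 𝟙 b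
unitExcess {m} m≤x x≤1+m with m≤n⇒m<n∨m≡n x≤1+m
... | inj₁ x≤m  = false , trans (≤-antisym (≤-pred x≤m) m≤x) (sym (+-identityʳ m))
... | inj₂ refl = true , +-comm 1 m

excessTable : ∀ {m} (X : Word k → ℕ) → X 𝟎 ≡ 0 →
  (∀ v → T (nonzero? v) → m ≤ X v × X v ≤ suc m) →
  ∃ λ (t : Table k Bool) → ∀ w → X w ≡ m * 𝟙 (nonzero? w) + 𝟙 (lookup t w)
excessTable {m = m} X X𝟎≡0 near =
  tabulate (proj₁ ∘ excess) , λ w →
    trans (proj₂ (excess w))
          (cong (λ b → m * 𝟙 (nonzero? w) + 𝟙 b) (sym (lookup∘tabulate (proj₁ ∘ excess) w)))
  where
  excess : ∀ w → ∃ λ b → X w ≡ m * 𝟙 (nonzero? w) + 𝟙 b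
  excess w with nonzero? w in eq
  ... | false = false ,
    trans (cong X (zero⇒≡𝟎 w eq)) (trans X𝟎≡0 (sym (trans (+-identityʳ _) (*-zeroʳ m))))
  ... | true  = let (b , Xw≡) = uncurry unitExcess (near w (subst T (sym eq) _))
                in b , trans Xw≡ (cong (_+ 𝟙 b) (sym (*-identityʳ m)))

∈023⇒≤3 : ∀ {r} → r ≡ 0 ⊎ r ≡ 2 ⊎ r ≡ 3 → r ≤ 3
∈023⇒≤3 (inj₁ refl)        = z≤n
∈023⇒≤3 (inj₂ (inj₁ refl)) = s≤s (s≤s z≤n)
∈023⇒≤3 (inj₂ (inj₂ refl)) = ≤-refl

hullNontrivial : ∀ {m r} (X : Word 3 → ℕ) → r ≡ 0 ⊎ r ≡ 2 ⊎ r ≡ 3 →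
  ⟨ X , (λ _ → 1) ⟩ ≡ 7 * m + 2 * r → (∀ u → T (nonzero? u) → 4 * m + r ≤ weight X u) →
  HullNontrivial X
hullNontrivial {m} {r} X r∈ length d≤wt =
  lift (shortCode⇒hullNontrivial r r∈ t (shortLength , shortWeight))
  where
  excess : ∃ λ (t : Table 3 Bool) → ∀ w → X w ≡ m * 𝟙 (nonzero? w) + 𝟙 (lookup t w)
  excess = uncurry (excessTable X) (columnMultiplicities {m} X (∈023⇒≤3 r∈) length d≤wt)
  t : Table 3 Bool
  t = proj₁ excess
  s : Word 3 → ℕ
  s = 𝟙 ∘ lookup t
  decomposition : ∀ w → X w ≡ m * 𝟙 (nonzero? w) + s w
  decomposition = proj₂ excess
  split : ∀ g → ⟨ X , g ⟩ ≡ m * ⟨ 𝟙 ∘ nonzero? , g ⟩ + ⟨ s , g ⟩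
  split = ⟨⟩-split m X (𝟙 ∘ nonzero?) s decomposition
  shortLength : ⟨ s , (λ _ → 1) ⟩ ≡ 2 * r
  shortLength = +-cancelˡ-≡ (7 * m) _ _ (begin
    7 * m + ⟨ s , (λ _ → 1) ⟩                                ≡⟨ cong (_+ ⟨ s , (λ _ → 1) ⟩) (*-comm 7 m) ⟩
    m * 7 + ⟨ s , (λ _ → 1) ⟩                                ≡⟨ cong (λ x → m * x + ⟨ s , (λ _ → 1) ⟩) simplex-length ⟨
    m * ⟨ 𝟙 ∘ nonzero? {3} , (λ _ → 1) ⟩ + ⟨ s , (λ _ → 1) ⟩ ≡⟨ split (λ _ → 1) ⟨
    ⟨ X , (λ _ → 1) ⟩                                        ≡⟨ length ⟩
    7 * m + 2 * r                                            ∎)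
    where open ≡-Reasoning
  shortWeight : ∀ u → T (nonzero? u) → r ≤ weight s u
  shortWeight u nz = +-cancelˡ-≤ (4 * m) _ _ (subst (4 * m + r ≤_) wt≡ (d≤wt u nz))
    where
    wt≡ : weight X u ≡ 4 * m + weight s u
    wt≡ = trans (split (λ w → 𝟙 (u · w)))
                (cong (_+ weight s u) (trans (cong (m *_) (simplex-weight u nz)) (*-comm m 4)))
  lift : HullNontrivial s → HullNontrivial X
  lift (c , nz , s-hull) =
    c , nz , inHull-split m X (𝟙 ∘ nonzero?) s decomposition c (simplex-selfOrthogonal c) s-hull

noLCD : ∀ {n m r} → r ≡ 0 ⊎ r ≡ 2 ⊎ r ≡ 3 → n ≡ 7 * m + 2 * r → (G : GenMat 3 n) → LinIndep G →
  (∀ w → w ∈C G → w ≢ 𝟎 → 4 * m + r ≤ wt w) → ¬ IsLCD G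
noLCD {m = m} {r} r∈ n≡ G indep minWt lcd =
  let (c , nz , hull) = hullNontrivial {m} X r∈ (trans (multiplicity-total (columns G)) n≡) weights
  in nonzero⇒≢𝟎 c nz (indep c (lcd (combo G c) (c , refl) (InHull⇒orthogonal G c hull)))
  where
  X : Word 3 → ℕ
  X = multiplicity (columns G)
  weights : ∀ u → T (nonzero? u) → 4 * m + r ≤ weight X u
  weights u nz =
    subst (4 * m + r ≤_) (wt-combo G u) (minWt (combo G u) (u , refl) (nonzero⇒≢𝟎 u nz ∘ indep u))

⌊4n/7⌋ : ∀ n → (4 * n) / 7 ≡ 4 * (n / 7) + (4 * (n % 7)) / 7
⌊4n/7⌋ n = begin
  (4 * n) / 7                               ≡⟨ cong (λ x → (4 * x) / 7) (m≡m%n+[m/n]*n n 7) ⟩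
  (4 * (n % 7 + n / 7 * 7)) / 7             ≡⟨ cong (_/ 7) (*-distribˡ-+ 4 (n % 7) _) ⟩
  (4 * (n % 7) + 4 * (n / 7 * 7)) / 7       ≡⟨ cong (λ x → (4 * (n % 7) + x) / 7) (sym (*-assoc 4 (n / 7) 7)) ⟩
  (4 * (n % 7) + 4 * (n / 7) * 7) / 7       ≡⟨ +-distrib-/-∣ʳ (4 * (n % 7)) (divides-refl (4 * (n / 7))) ⟩
  (4 * (n % 7)) / 7 + 4 * (n / 7) * 7 / 7   ≡⟨ cong ((4 * (n % 7)) / 7 +_) (m*n/n≡m (4 * (n / 7)) 7) ⟩
  (4 * (n % 7)) / 7 + 4 * (n / 7)           ≡⟨ +-comm _ (4 * (n / 7)) ⟩
  4 * (n / 7) + (4 * (n % 7)) / 7           ∎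
  where open ≡-Reasoning

residue-split : ∀ n r → n % 7 ≡ 2 * r → (4 * (2 * r)) / 7 ≡ r →
  n ≡ 7 * (n / 7) + 2 * r × (4 * n) / 7 ≡ 4 * (n / 7) + r
residue-split n r r≡ q≡ =
  trans (m≡m%n+[m/n]*n n 7)
        (trans (cong (_+ n / 7 * 7) r≡) (trans (+-comm (2 * r) _) (cong (_+ 2 * r) (*-comm (n / 7) 7)))) ,
  trans (⌊4n/7⌋ n) (cong (4 * (n / 7) +_) (trans (cong (λ x → (4 * x) / 7) r≡) q≡))

residue-classes : ∀ n → n % 7 ≡ 0 ⊎ n % 7 ≡ 4 ⊎ n % 7 ≡ 6 →
  ∃ λ r → (r ≡ 0 ⊎ r ≡ 2 ⊎ r ≡ 3) × n ≡ 7 * (n / 7) + 2 * r × (4 * n) / 7 ≡ 4 * (n / 7) + r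
residue-classes n (inj₁ n%7≡)        = 0 , inj₁ refl , residue-split n 0 n%7≡ refl
residue-classes n (inj₂ (inj₁ n%7≡)) = 2 , inj₂ (inj₁ refl) , residue-split n 2 n%7≡ refl
residue-classes n (inj₂ (inj₂ n%7≡)) = 3 , inj₂ (inj₂ refl) , residue-split n 3 n%7≡ refl

lemma5p5 : (n : ℕ) → 0 < n → (n % 7 ≡ 0 ⊎ n % 7 ≡ 4 ⊎ n % 7 ≡ 6) →
    ¬ (Σ (GenMat 3 n) λ G → Is[ n , 3 , (4 * n) / 7 ]Code G × IsLCD G)
lemma5p5 n _ n%7 (G , (indep , minWt , _) , lcd) with residue-classes n n%7
... | r , r∈ , n≡ , d≡ =
  noLCD {m = n / 7} r∈ n≡ G indep (λ w w∈G w≢𝟎 → subst (_≤ wt w) d≡ (minWt w w∈G w≢𝟎)) lcd
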